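{- Let $f$ be as defined in the context. Suppose $n,a\in\mathbb{N}^+$ satisfy $n\ge\lceil\log_2 a\rceil+1$ and $f(n,a)<f(n+1,a)$. Then in every union-closed family $\mathcal{F}$ on ground set $[n+1]$ with $\mathcal{S}(\mathcal{F})\ne\emptyset$, $a(\mathcal{F})\le a$ and $m(\mathcal{F})=f(n+1,a)$, every element $e\in[n+1]$ is the twin difference of at least one pair of sets of $\mathcal{F}$, i.e. there exists $S\in\mathcal{S}(\mathcal{F})$ with $e\notin S$ and $S\cup\{e\}\in\mathcal{S}(\mathcal{F})$.
   Context: A family $\mathcal{F}$ on ground set $[n]=\{1,\dots,n\}$ is a collection $\mathcal{S}(\mathcal{F})$ of distinct subsets of $[n]$ (elements of $[n]$ may lie in no set); $m(\mathcal{F})=|\mathcal{S}(\mathcal{F})|$. It is union-closed if $S\cup T\in\mathcal{S}(\mathcal{F})$ whenever $S,T\in\mathcal{S}(\mathcal{F})$. For $e\in[n]$, $m_e(\mathcal{F})$ is the number of sets of $\mathcal{F}$ containing $e$, and $a(\mathcal{F})=\max_{e\in[n]}m_e(\mathcal{F})$. For $n,a\in\mathbb{N}^+$, $f(n,a)$ is the maximum of $m(\mathcal{F})$ over all union-closed families $\mathcal{F}$ on ground set $[n]$ with $\mathcal{S}(\mathcal{F})\neq\emptyset$ and $a(\mathcal{F})\le a$. Two sets $S_2\subsetneq S_1$ with $S_1\setminus S_2=\{e\}$ are twin sets with twin difference $e$. -}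

module Defs where

open import Data.Nat using (ℕ; suc; _≤_; _<_; _+_)
open import Data.Nat.Logarithm using (⌈log₂_⌉)
open import Data.Fin using (Fin)
open import Data.Fin.Subset using (Subset; _∈_; _∉_; _∪_; ⁅_⁆)
open import Data.Fin.Subset.Properties using (_∈?_)
open import Data.List using (List; []; length; filter)
open import Data.List.Relation.Unary.Unique.Propositional using (Unique)
import Data.List.Membership.Propositional as M
open import Data.Product using (Σ; _×_)
open import Relation.Binary.PropositionalEquality using (_≡_)
open import Relation.Nullary using (¬_)

-- A family on ground set [n] = Fin n: a list of subsets of Fin n with
-- no repetitions (so the list represents the collection S(F) of distinct sets).
record Family (n : ℕ) : Set where
  constructor mkFamily
  field
    sets     : List (Subset n)
    distinct : Unique sets
open Family public

_∈ₛ_ : {n : ℕ} → Subset n → Family n → Set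
S ∈ₛ F = S M.∈ sets F

m : {n : ℕ} → Family n → ℕ
m F = length (sets F)

mₑ : {n : ℕ} → Family n → Fin n → ℕ
mₑ F e = length (filter (e ∈?_) (sets F))

UnionClosed : {n : ℕ} → Family n → Set
UnionClosed F = ∀ {S T} → S ∈ₛ F → T ∈ₛ F → (S ∪ T) ∈ₛ F

NonEmpty : {n : ℕ} → Family n → Set
NonEmpty F = ¬ (sets F ≡ [])

aBounded : {n : ℕ} → Family n → ℕ → Set
aBounded F a = ∀ e → mₑ F e ≤ a

Admissible : {n : ℕ} → Family n → ℕ → Set
Admissible F a = UnionClosed F × NonEmpty F × aBounded F a

-- IsF n a k  :⇔  k = f(n,a), i.e. k is the maximum of m(F) over admissible F.
IsF : ℕ → ℕ → ℕ → Set
IsF n a k = Σ (Family n) (λ F → Admissible F a × m F ≡ k)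
          × (∀ (F : Family n) → Admissible F a → m F ≤ k)

IsTwinDifference : {n : ℕ} → Family n → Fin n → Set
IsTwinDifference F e = Σ (Subset _) (λ S → S ∈ₛ F × e ∉ S × (S ∪ ⁅ e ⁆) ∈ₛ F)

module Submission where

-- If e is not a twin difference of F, then deleting e from every set of F
-- is injective on F, since two distinct sets with the same trace off e
-- differ exactly in e. The traces form an admissible family on [n] of the
-- same size, so f(n+1,a) = m(F) ≤ f(n,a), contradicting f(n,a) < f(n+1,a).
-- The maxima f(n,a), f(n+1,a) exist only up to double negation here, which
-- suffices because being a twin difference is decidable.

open import Defs
open import Data.Nat using (ℕ; zero; suc; _≤_; _<_; _+_; z≤n; s≤s; s≤s⁻¹)
open import Data.Nat.Logarithm using (⌈log₂_⌉)
open import Data.Fin using (Fin; zero; suc; punchIn)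
open import Data.Bool using (_∨_)
import Data.Bool as Bool
open import Data.Empty using (⊥-elim)
open import Data.Fin.Subset using (Subset; outside; inside; _∪_; ⁅_⁆; ⊥)
  renaming (_∈_ to _∈ˢ_; _∉_ to _∉ˢ_)
open import Data.Fin.Subset.Properties using (_∈?_; x∈⁅x⁆; x∈p∪q⁺; ∪-identityʳ)
open import Data.List using (List; []; _∷_; length; filter; map; _++_)
open import Data.List.Properties using (length-map; length-removeAt′; filter-≐)
open import Data.List.Relation.Unary.All as All using ()
open import Data.List.Relation.Unary.All.Properties using (map⁺)
open import Data.List.Relation.Unary.Any using (here; there; any?; _─_)
open import Data.List.Relation.Unary.Unique.Propositional using (Unique; []; _∷_)
open import Data.List.Membership.Propositional using (_∈_; find; lose)
open import Data.List.Membership.Propositional.Properties using (∈-map⁺; ∈-map⁻; ∈-++⁺ˡ; ∈-++⁺ʳ)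
import Data.List.Membership.DecPropositional as DecMembership
open import Data.Nat.Properties using (≤-trans; ≤∧≢⇒<; <⇒≱)
open import Data.Product using (Σ; ∃; _×_; _,_)
open import Data.Sum using (_⊎_; inj₁; inj₂)
open import Data.Vec using (Vec; _∷_; lookup; zipWith; removeAt; insertAt) renaming ([] to []ᵛ)
open import Data.Vec.Properties using (insertAt-removeAt; []=⇒lookup; lookup⇒[]=; ≡-dec)
open import Relation.Nullary using (¬_; Dec; yes; no; ¬?; _×-dec_)
open import Relation.Nullary.Decidable using (map′; decidable-stable; ¬¬-excluded-middle)
open import Relation.Binary.PropositionalEquality using (_≡_; _≢_; refl; sym; trans; cong; cong₂; subst; module ≡-Reasoning)

module _ {A : Set} where

  ∈-─ : ∀ {x y} {xs : List A} → y ∈ xs → y ≢ x → (x∈xs : x ∈ xs) → y ∈ (xs ─ x∈xs)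
  ∈-─ (here refl) y≢x (here refl) = ⊥-elim (y≢x refl)
  ∈-─ (here y≡z)  y≢x (there _)   = here y≡z
  ∈-─ (there y∈)  y≢x (here _)    = y∈
  ∈-─ (there y∈)  y≢x (there x∈)  = there (∈-─ y∈ y≢x x∈)

  Unique∧⊆⇒length≤ : ∀ {xs ys : List A} → Unique xs → (∀ {x} → x ∈ xs → x ∈ ys) →
                     length xs ≤ length ys
  Unique∧⊆⇒length≤ {[]}     _          _  = z≤n
  Unique∧⊆⇒length≤ {x ∷ xs} {ys} (x∉xs ∷ u) xs⊆ys =
    subst (suc (length xs) ≤_) (sym (length-removeAt′ ys _))
      (s≤s (Unique∧⊆⇒length≤ u λ y∈xs →
        ∈-─ (xs⊆ys (there y∈xs)) (λ y≡x → All.lookup x∉xs y∈xs (sym y≡x)) x∈ys))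
    where x∈ys = xs⊆ys (here refl)

  map⁺-Unique : ∀ {B : Set} (f : A → B) {xs : List A} → Unique xs →
                (∀ {x y} → x ∈ xs → y ∈ xs → f x ≡ f y → x ≡ y) → Unique (map f xs)
  map⁺-Unique f []            _   = []
  map⁺-Unique f (x∉xs ∷ u) inj =
    map⁺ (All.tabulate λ y∈xs fx≡fy → All.lookup x∉xs y∈xs (inj (here refl) (there y∈xs) fx≡fy))
    ∷ map⁺-Unique f u (λ x∈ y∈ → inj (there x∈) (there y∈))

  map-≡[] : ∀ {B : Set} {f : A → B} {xs : List A} → map f xs ≡ [] → xs ≡ []
  map-≡[] {xs = []} _ = refl

  filter-map : ∀ {B : Set} {P : B → Set} (P? : ∀ y → Dec (P y)) (f : A → B) (xs : List A) →
               filter P? (map f xs) ≡ map f (filter (λ x → P? (f x)) xs)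
  filter-map P? f []       = refl
  filter-map P? f (x ∷ xs) with P? (f x)
  ... | yes _ = cong (f x ∷_) (filter-map P? f xs)
  ... | no  _ = filter-map P? f xs

  lookup-removeAt : ∀ {n} (xs : Vec A (suc n)) (i : Fin (suc n)) (j : Fin n) →
                    lookup (removeAt xs i) j ≡ lookup xs (punchIn i j)
  lookup-removeAt (x ∷ xs)     zero    j       = refl
  lookup-removeAt (x ∷ y ∷ xs) (suc i) zero    = refl
  lookup-removeAt (x ∷ y ∷ xs) (suc i) (suc j) = lookup-removeAt (y ∷ xs) i j

  removeAt-injective : ∀ {n} (xs ys : Vec A (suc n)) (i : Fin (suc n)) →
                       lookup xs i ≡ lookup ys i → removeAt xs i ≡ removeAt ys i → xs ≡ ys
  removeAt-injective xs ys i xᵢ≡yᵢ rest≡ = begin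
    xs                                       ≡⟨ sym (insertAt-removeAt xs i) ⟩
    insertAt (removeAt xs i) i (lookup xs i) ≡⟨ cong₂ (λ zs z → insertAt zs i z) rest≡ xᵢ≡yᵢ ⟩
    insertAt (removeAt ys i) i (lookup ys i) ≡⟨ insertAt-removeAt ys i ⟩
    ys                                       ∎
    where open ≡-Reasoning

  removeAt-zipWith : ∀ {n} (f : A → A → A) (xs ys : Vec A (suc n)) (i : Fin (suc n)) →
                     removeAt (zipWith f xs ys) i ≡ zipWith f (removeAt xs i) (removeAt ys i)
  removeAt-zipWith f (x ∷ xs)      (y ∷ ys)      zero    = refl
  removeAt-zipWith f (x ∷ x′ ∷ xs) (y ∷ y′ ∷ ys) (suc i) =
    cong (f x y ∷_) (removeAt-zipWith f (x′ ∷ xs) (y′ ∷ ys) i)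

Maximum : (ℕ → Set) → Set
Maximum P = Σ ℕ λ k → P k × (∀ j → P j → j ≤ k)

bounded⇒¬¬maximum : ∀ {P : ℕ → Set} (B : ℕ) → (∀ j → P j → j ≤ B) → ∃ P → ¬ ¬ Maximum P
bounded⇒¬¬maximum zero    bound (k , Pk) ¬max =
  ¬max (k , Pk , λ j Pj → ≤-trans (bound j Pj) z≤n)
bounded⇒¬¬maximum (suc B) bound P∃ ¬max = ¬¬-excluded-middle λ where
  (yes PB) → ¬max (suc B , PB , bound)
  (no ¬PB) → bounded⇒¬¬maximum B
    (λ j Pj → s≤s⁻¹ (≤∧≢⇒< (bound j Pj) λ { refl → ¬PB Pj })) P∃ ¬max

allSubsets : (n : ℕ) → List (Subset n)
allSubsets zero    = []ᵛ ∷ []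
allSubsets (suc n) = map (inside ∷_) (allSubsets n) ++ map (outside ∷_) (allSubsets n)

∈-allSubsets : ∀ {n} (S : Subset n) → S ∈ allSubsets n
∈-allSubsets []ᵛ = here refl
∈-allSubsets {suc n} (inside ∷ S)  = ∈-++⁺ˡ (∈-map⁺ (inside ∷_) (∈-allSubsets S))
∈-allSubsets {suc n} (outside ∷ S) =
  ∈-++⁺ʳ (map (inside ∷_) (allSubsets n)) (∈-map⁺ (outside ∷_) (∈-allSubsets S))

f-exists : ∀ {n a} (G : Family n) → Admissible G a → ¬ ¬ ∃ (IsF n a)
f-exists {n} {a} G admG ¬f =
  bounded⇒¬¬maximum (length (allSubsets n))
    (λ { _ (H , _ , refl) → Unique∧⊆⇒length≤ (distinct H) (λ {S} _ → ∈-allSubsets S) })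
    (m G , G , admG , refl)
    (λ (k , attained , maximal) → ¬f (k , attained , λ H admH → maximal (m H) (H , admH , refl)))

removeAt-⁅⁆ : ∀ {n} (i : Fin (suc n)) → removeAt ⁅ i ⁆ i ≡ ⊥
removeAt-⁅⁆ zero          = refl
removeAt-⁅⁆ (suc zero)    = refl
removeAt-⁅⁆ (suc (suc i)) = cong (outside ∷_) (removeAt-⁅⁆ (suc i))

module _ {n : ℕ} (e : Fin (suc n)) where

  erase : Subset (suc n) → Subset n
  erase S = removeAt S e

  ∈-erase⁻ : ∀ {S x} → x ∈ˢ erase S → punchIn e x ∈ˢ S
  ∈-erase⁻ {S} {x} x∈ =
    lookup⇒[]= (punchIn e x) S (trans (sym (lookup-removeAt S e x)) ([]=⇒lookup x∈))

  ∈-erase⁺ : ∀ {S x} → punchIn e x ∈ˢ S → x ∈ˢ erase S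
  ∈-erase⁺ {S} {x} x∈ =
    lookup⇒[]= x (erase S) (trans (lookup-removeAt S e x) ([]=⇒lookup x∈))

  erase-∪ : ∀ S T → erase (S ∪ T) ≡ erase S ∪ erase T
  erase-∪ S T = removeAt-zipWith _∨_ S T e

  erase-∪⁅⁆ : ∀ S → erase (S ∪ ⁅ e ⁆) ≡ erase S
  erase-∪⁅⁆ S = begin
    erase (S ∪ ⁅ e ⁆)     ≡⟨ erase-∪ S ⁅ e ⁆ ⟩
    erase S ∪ erase ⁅ e ⁆ ≡⟨ cong (erase S ∪_) (removeAt-⁅⁆ e) ⟩
    erase S ∪ ⊥           ≡⟨ ∪-identityʳ (erase S) ⟩
    erase S               ∎
    where open ≡-Reasoning

  lookup≡outside⇒∉ : ∀ {S} → lookup S e ≡ outside → e ∉ˢ S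
  lookup≡outside⇒∉ eS e∈S with () ← trans (sym ([]=⇒lookup e∈S)) eS

  erase-≡⇒≡∪⁅⁆ : ∀ S T → lookup T e ≡ inside → erase S ≡ erase T → T ≡ S ∪ ⁅ e ⁆
  erase-≡⇒≡∪⁅⁆ S T eT same = removeAt-injective T (S ∪ ⁅ e ⁆) e
    (trans eT (sym ([]=⇒lookup (x∈p∪q⁺ {p = S} (inj₂ (x∈⁅x⁆ e))))))
    (trans (sym same) (sym (erase-∪⁅⁆ S)))

  TwinPair : Subset (suc n) → Subset (suc n) → Set
  TwinPair S T = e ∉ˢ S × T ≡ S ∪ ⁅ e ⁆

  erase-≡⇒≡⊎twins : ∀ S T → erase S ≡ erase T → S ≡ T ⊎ TwinPair S T ⊎ TwinPair T S
  erase-≡⇒≡⊎twins S T same with lookup S e in eS | lookup T e in eT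
  ... | inside  | inside  = inj₁ (removeAt-injective S T e (trans eS (sym eT)) same)
  ... | outside | outside = inj₁ (removeAt-injective S T e (trans eS (sym eT)) same)
  ... | outside | inside  = inj₂ (inj₁ (lookup≡outside⇒∉ eS , erase-≡⇒≡∪⁅⁆ S T eT same))
  ... | inside  | outside = inj₂ (inj₂ (lookup≡outside⇒∉ eT , erase-≡⇒≡∪⁅⁆ T S eS (sym same)))

twinDifference? : ∀ {n} (F : Family n) (e : Fin n) → Dec (IsTwinDifference F e)
twinDifference? F e =
  map′ find (λ (S , S∈F , twin) → lose S∈F twin)
    (any? (λ S → ¬? (e ∈? S) ×-dec ((S ∪ ⁅ e ⁆) ∈ᴸ? sets F)) (sets F))
  where open DecMembership (≡-dec Bool._≟_) using () renaming (_∈?_ to _∈ᴸ?_)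

module _ {n : ℕ} (F : Family (suc n)) (e : Fin (suc n)) (¬twin : ¬ IsTwinDifference F e) where

  erase-injectiveOn : ∀ {S T} → S ∈ₛ F → T ∈ₛ F → erase e S ≡ erase e T → S ≡ T
  erase-injectiveOn {S} {T} S∈F T∈F same with erase-≡⇒≡⊎twins e S T same
  ... | inj₁ S≡T                 = S≡T
  ... | inj₂ (inj₁ (e∉S , T≡S+e)) = ⊥-elim (¬twin (S , S∈F , e∉S , subst (_∈ₛ F) T≡S+e T∈F))
  ... | inj₂ (inj₂ (e∉T , S≡T+e)) = ⊥-elim (¬twin (T , T∈F , e∉T , subst (_∈ₛ F) S≡T+e S∈F))

  eraseFamily : Family n
  eraseFamily =
    mkFamily (map (erase e) (sets F)) (map⁺-Unique (erase e) (distinct F) erase-injectiveOn)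

  m-eraseFamily : m eraseFamily ≡ m F
  m-eraseFamily = length-map (erase e) (sets F)

  mₑ-eraseFamily : ∀ x → mₑ eraseFamily x ≡ mₑ F (punchIn e x)
  mₑ-eraseFamily x = begin
    length (filter (x ∈?_) (map (erase e) (sets F)))
      ≡⟨ cong length (filter-map (x ∈?_) (erase e) (sets F)) ⟩
    length (map (erase e) (filter x∈erase? (sets F)))
      ≡⟨ length-map (erase e) (filter x∈erase? (sets F)) ⟩
    length (filter x∈erase? (sets F))
      ≡⟨ cong length (filter-≐ x∈erase? (punchIn e x ∈?_) (∈-erase⁻ e , ∈-erase⁺ e) (sets F)) ⟩
    length (filter (punchIn e x ∈?_) (sets F))
      ∎
    where
    open ≡-Reasoning
    x∈erase? : ∀ S → Dec (x ∈ˢ erase e S)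
    x∈erase? S = x ∈? erase e S

  eraseFamily-unionClosed : UnionClosed F → UnionClosed eraseFamily
  eraseFamily-unionClosed closed X∈ Y∈ with ∈-map⁻ (erase e) X∈ | ∈-map⁻ (erase e) Y∈
  ... | S , S∈F , refl | T , T∈F , refl =
    subst (_∈ map (erase e) (sets F)) (erase-∪ e S T) (∈-map⁺ (erase e) (closed S∈F T∈F))

  eraseFamily-admissible : ∀ {a} → Admissible F a → Admissible eraseFamily a
  eraseFamily-admissible (closed , nonEmpty , bounded) =
    eraseFamily-unionClosed closed ,
    (λ empty → nonEmpty (map-≡[] empty)) ,
    (λ x → subst (_≤ _) (sym (mₑ-eraseFamily x)) (bounded (punchIn e x)))

¬twin⇒m≤f : ∀ {n a k} (F : Family (suc n)) (e : Fin (suc n)) → ¬ IsTwinDifference F e →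
            Admissible F a → IsF n a k → m F ≤ k
¬twin⇒m≤f F e ¬twin admF (_ , maximal) =
  subst (_≤ _) (m-eraseFamily F e ¬twin)
    (maximal (eraseFamily F e ¬twin) (eraseFamily-admissible F e ¬twin admF))

lemma3p2 : (n a : ℕ) → 1 ≤ n → 1 ≤ a → ⌈log₂ a ⌉ + 1 ≤ n
    → (∀ k₁ k₂ → IsF n a k₁ → IsF (suc n) a k₂ → k₁ < k₂)
    → (F : Family (suc n)) → Admissible F a
    → (∀ k → IsF (suc n) a k → m F ≡ k)
    → (e : Fin (suc n)) → IsTwinDifference F e
lemma3p2 n a _ _ _ f<f F admF F-maximum e =
  decidable-stable (twinDifference? F e) λ ¬twin →
    f-exists (eraseFamily F e ¬twin) (eraseFamily-admissible F e ¬twin admF) λ (k₁ , isF₁) →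
    f-exists F admF λ (k₂ , isF₂) →
    <⇒≱ (f<f k₁ k₂ isF₁ isF₂)
        (subst (_≤ k₁) (F-maximum k₂ isF₂) (¬twin⇒m≤f F e ¬twin admF isF₁))
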